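{- Let $G=(V,E)$ be a bipartite graph in which every vertex ranks its neighbours in a linearly ordered list of ties, and let $FSUSM(G,P)$ be the set of $x\in\mathbb{R}^E$ satisfying $\sum_{u\in N(v)}x_{u,v}\le 1$ for all $v\in V$, $\sum_{i>_u v}x_{u,i}+\sum_{j>_v u}x_{j,v}+x_{u,v}\ge 1$ for all $(u,v)\in E$, and $x_{u,v}\ge 0$ for all $(u,v)\in E$. Consider the linear program (LP): maximize $\sum_{(u,v)\in E}x_{u,v}$ subject to $x\in FSUSM(G,P)$, and the linear program (DLP) in variables $(\alpha,\beta)\in\mathbb{R}^V\times\mathbb{R}^E$: minimize $\sum_{v\in V}\alpha_v-\sum_{(u,v)\in E}\beta_{u,v}$ subject to $\alpha_u+\alpha_v-\sum_{i<_u v}\beta_{u,i}-\sum_{j<_v u}\beta_{v,j}-\beta_{u,v}\ge 1$ for all $(u,v)\in E$, $\alpha_v\ge 0$ for all $v\in V$, and $\beta_{u,v}\ge 0$ for all $(u,v)\in E$. Then every $x\in FSUSM(G,P)$ is an optimal solution of (LP), and $(\alpha,x)$ is an optimal solution of (DLP), where $\alpha_v=\sum_{i\in N(v)}x_{v,i}$ for all $v\in V$.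
   Context: $N(v)$ is the neighbour set of $v$. For each vertex $u$, its preference over $N(u)$ is a weak order; $i>_u v$ ($i<_u v$) means $u$ strictly prefers $i$ to $v$ ($v$ to $i$), and sums such as $\sum_{i>_u v}$ range over neighbours $i$ of $u$ with that property. Variables indexed by an edge are symmetric in its endpoints: $x_{u,v}=x_{v,u}$ and $\beta_{u,v}=\beta_{v,u}$ denote the coordinate of edge $\{u,v\}$. -}

module Defs where

open import Level using (Level; _⊔_) renaming (suc to lsuc)
open import Algebra.Bundles using (CommutativeRing)
open import Relation.Binary.Structures using (IsTotalOrder)
open import Relation.Nullary using (¬_)
open import Relation.Nullary.Decidable using (⌊_⌋)
open import Data.Bool using (Bool; true; false; _∧_)
open import Data.Nat as ℕ using (ℕ; zero; suc)
open import Data.Fin using (Fin)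
import Data.Fin as Fin
open import Data.Product using (∃; _×_)
open import Relation.Binary.PropositionalEquality using (_≡_)

-- An ordered field (the statement is about ℝ; we state it for an arbitrary
-- ordered field, of which ℝ is an instance).
record OrderedField (c ℓ₁ ℓ₂ : Level) : Set (lsuc (c ⊔ ℓ₁ ⊔ ℓ₂)) where
  field
    commutativeRing : CommutativeRing c ℓ₁
  open CommutativeRing commutativeRing public
  infix 4 _≤_
  field
    _≤_          : Carrier → Carrier → Set ℓ₂
    isTotalOrder : IsTotalOrder _≈_ _≤_
    +-mono-≤     : ∀ {x y} z → x ≤ y → (x + z) ≤ (y + z)
    *-nonneg     : ∀ {x y} → 0# ≤ x → 0# ≤ y → 0# ≤ (x * y)
    0≉1          : ¬ (0# ≈ 1#)
    inverse      : ∀ x → ¬ (x ≈ 0#) → ∃ λ y → (x * y) ≈ 1#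

-- Bipartite graph with sides Fin m ("left") and Fin n ("right"):
--   adj i j ≡ true  iff  {i , j} ∈ E.
-- Preferences (weak orders = linearly ordered lists of ties) given by ranks:
--   rL i j : position of the tie containing right vertex j in the list of left vertex i,
--   rR j i : position of the tie containing left vertex i in the list of right vertex j;
--   smaller rank = more preferred, equal rank = tie. Ranks of non-neighbours are ignored.
-- Edge-indexed vectors (ℝ^E) are functions Fin m → Fin n → Carrier; only values
-- on edges matter (every constraint and sum is restricted to edges).
module LP {c ℓ₁ ℓ₂} (F : OrderedField c ℓ₁ ℓ₂)
          (m n : ℕ) (adj : Fin m → Fin n → Bool)
          (rL : Fin m → Fin n → ℕ) (rR : Fin n → Fin m → ℕ) where
  open OrderedField F

  _−_ : Carrier → Carrier → Carrier
  a − b = a + (- b)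

  Σ : ∀ k → (Fin k → Carrier) → Carrier
  Σ zero    f = 0#
  Σ (suc k) f = f Fin.zero + Σ k (λ i → f (Fin.suc i))

  [_]·_ : Bool → Carrier → Carrier
  [ true  ]· a = a
  [ false ]· a = 0#

  _<ᵇ_ : ℕ → ℕ → Bool
  a <ᵇ b = ⌊ a ℕ.<? b ⌋

  EdgeVec : Set c
  EdgeVec = Fin m → Fin n → Carrier

  degL : EdgeVec → Fin m → Carrier
  degL x i = Σ n (λ k → [ adj i k ]· x i k)

  degR : EdgeVec → Fin n → Carrier
  degR x j = Σ m (λ l → [ adj l j ]· x l j)

  betterL : EdgeVec → Fin m → Fin n → Carrier
  betterL x i j = Σ n (λ k → [ adj i k ∧ (rL i k <ᵇ rL i j) ]· x i k)

  betterR : EdgeVec → Fin m → Fin n → Carrier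
  betterR x i j = Σ m (λ l → [ adj l j ∧ (rR j l <ᵇ rR j i) ]· x l j)

  worseL : EdgeVec → Fin m → Fin n → Carrier
  worseL x i j = Σ n (λ k → [ adj i k ∧ (rL i j <ᵇ rL i k) ]· x i k)

  worseR : EdgeVec → Fin m → Fin n → Carrier
  worseR x i j = Σ m (λ l → [ adj l j ∧ (rR j i <ᵇ rR j l) ]· x l j)

  edgeSum : EdgeVec → Carrier
  edgeSum x = Σ m (λ i → Σ n (λ j → [ adj i j ]· x i j))

  record FSUSM (x : EdgeVec) : Set (ℓ₂) where
    field
      capL   : ∀ i → degL x i ≤ 1#
      capR   : ∀ j → degR x j ≤ 1#
      stable : ∀ i j → adj i j ≡ true → 1# ≤ ((betterL x i j + betterR x i j) + x i j)
      nonneg : ∀ i j → adj i j ≡ true → 0# ≤ x i j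

  LPOptimal : EdgeVec → Set (c ⊔ ℓ₂)
  LPOptimal x = FSUSM x × (∀ y → FSUSM y → edgeSum y ≤ edgeSum x)

  -- (DLP) variables: α on V = (Fin m ⊎ Fin n), given as αL, αR; β ∈ ℝ^E
  record DLPFeasible (αL : Fin m → Carrier) (αR : Fin n → Carrier) (β : EdgeVec) : Set ℓ₂ where
    field
      cover   : ∀ i j → adj i j ≡ true →
                1# ≤ ((((αL i + αR j) − worseL β i j) − worseR β i j) − β i j)
      αL-nonneg : ∀ i → 0# ≤ αL i
      αR-nonneg : ∀ j → 0# ≤ αR j
      β-nonneg  : ∀ i j → adj i j ≡ true → 0# ≤ β i j

  dualObj : (Fin m → Carrier) → (Fin n → Carrier) → EdgeVec → Carrier
  dualObj αL αR β = (Σ m αL + Σ n αR) − edgeSum β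

  DLPOptimal : (Fin m → Carrier) → (Fin n → Carrier) → EdgeVec → Set (c ⊔ ℓ₂)
  DLPOptimal αL αR β =
    DLPFeasible αL αR β ×
    (∀ αL' αR' β' → DLPFeasible αL' αR' β' → dualObj αL αR β ≤ dualObj αL' αR' β')

-- The pair (α, β) = (deg x, x) is feasible for (DLP): at an edge {u,v}, the
-- neighbours that u does not rank strictly below v include v and everything u
-- prefers to v, so α_u − Σ_{i<_u v} x_{u,i} ≥ Σ_{i>_u v} x_{u,i} + x_{u,v};
-- adding the same bound at v and the stability constraint of x gives the cover
-- constraint. Its objective is Σ deg x − Σ x = 2 Σ x − Σ x = Σ x.
-- Conversely, for y ∈ FSUSM and any feasible (α, β), weighting the cover
-- constraint at e by y_e and summing gives Σ y ≤ Σ α − Σ β: the α-terms are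
-- controlled by the capacity constraints of y and, after exchanging the order
-- of summation, the β-terms become Σ_e β_e times the stability expression of y
-- at e, which is at least Σ β. So both optima are Σ x.
module Submission where

open import Defs
open import Algebra.Bundles using (CommutativeRing)
open import Data.Bool using (Bool; true; false; _∧_; not)
open import Data.Nat using (ℕ; zero; suc)
import Data.Nat.Properties as ℕ
open import Data.Fin using (Fin) renaming (zero to fzero; suc to fsuc)
open import Data.Fin.Properties using (_≟_)
open import Data.Maybe using (nothing)
open import Data.Product using (_×_; _,_)
open import Relation.Binary.Bundles using (Poset)
open import Relation.Binary.Structures using (IsTotalOrder)
open import Relation.Binary.PropositionalEquality as ≡ using (_≡_)
open import Relation.Nullary using (yes; no; does; contradiction)
open import Relation.Nullary.Decidable using (⌊_⌋)
open import Tactic.RingSolver using (solve-∀)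
open import Tactic.RingSolver.Core.AlmostCommutativeRing
  using (AlmostCommutativeRing; fromCommutativeRing)

-- Without a zero test the solver cannot cancel coefficients (x − x, or −(y w)
-- against y (−w)); identities needing that are derived by hand.
module CommutativeRingIdentities {c ℓ} (R : CommutativeRing c ℓ) where
  private
    R′ : AlmostCommutativeRing c ℓ
    R′ = fromCommutativeRing R (λ _ → nothing)

  open AlmostCommutativeRing R′
  open import Algebra.Properties.Ring (CommutativeRing.ring R) using (x[y-z]≈xy-xz)

  +-interchange : ∀ a b c d → (a + b) + (c + d) ≈ (a + c) + (b + d)
  +-interchange = solve-∀ R′

  *-distribˡ-+₃ : ∀ a p q r → a * ((p + q) + r) ≈ (a * p + a * q) + a * r
  *-distribˡ-+₃ = solve-∀ R′

  +-+-shuffle : ∀ p q x → (p + x) + (q + x) ≈ ((p + q) + x) + x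
  +-+-shuffle = solve-∀ R′

  −-+-shuffle : ∀ a b c d e → ((a + - b) + (c + - d)) + - e ≈ (((a + c) + - b) + - d) + - e
  −-+-shuffle = solve-∀ R′

  −-+-assoc₃ : ∀ s w₁ w₂ z → ((s + - w₁) + - w₂) + - z ≈ s + - ((w₁ + w₂) + z)
  −-+-assoc₃ = solve-∀ R′

  *-distribˡ-cover : ∀ y a b w₁ w₂ z →
    y * ((((a + b) + - w₁) + - w₂) + - z) ≈ (y * a + y * b) + - ((y * w₁ + y * w₂) + y * z)
  *-distribˡ-cover y a b w₁ w₂ z =
    trans (*-cong refl (−-+-assoc₃ (a + b) w₁ w₂ z))
      (trans (x[y-z]≈xy-xz y (a + b) ((w₁ + w₂) + z))
        (+-cong (distribˡ y a b) (-‿cong (*-distribˡ-+₃ y w₁ w₂ z))))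

<?-irrefl : ∀ a → ⌊ a ℕ.<? a ⌋ ≡ false
<?-irrefl a with a ℕ.<? a
... | yes a<a = contradiction a<a (ℕ.<-irrefl ≡.refl)
... | no _    = ≡.refl

<?-asym : ∀ {a b} → ⌊ a ℕ.<? b ⌋ ≡ true → ⌊ b ℕ.<? a ⌋ ≡ false
<?-asym {a} {b} a<b with a ℕ.<? b | b ℕ.<? a
... | yes a<b | yes b<a = contradiction b<a (ℕ.<-asym a<b)
... | yes _   | no _    = ≡.refl
... | no _    | _       = contradiction a<b λ ()

module OrderedFieldProperties {c ℓ₁ ℓ₂} (F : OrderedField c ℓ₁ ℓ₂) where
  open OrderedField F
  open import Algebra.Properties.Ring ring
    using (//-rightDividesˡ; -‿involutive; [y-z]x≈yx-zx)
  open IsTotalOrder isTotalOrder public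
    using () renaming (reflexive to ≤-reflexive; trans to ≤-trans)

  poset : Poset c ℓ₁ ℓ₂
  poset = record { isPartialOrder = IsTotalOrder.isPartialOrder isTotalOrder }

  +-mono₂-≤ : ∀ {a b c d} → a ≤ b → c ≤ d → a + c ≤ b + d
  +-mono₂-≤ {a} {b} {c} {d} a≤b c≤d =
    ≤-trans (+-mono-≤ c a≤b)
      (≤-trans (≤-reflexive (+-comm b c))
        (≤-trans (+-mono-≤ b c≤d) (≤-reflexive (+-comm d b))))

  ≤⇒0≤− : ∀ {a b} → a ≤ b → 0# ≤ b + - a
  ≤⇒0≤− {a} a≤b = ≤-trans (≤-reflexive (sym (-‿inverseʳ a))) (+-mono-≤ (- a) a≤b)

  0≤−⇒≤ : ∀ {a b} → 0# ≤ b + - a → a ≤ b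
  0≤−⇒≤ {a} {b} 0≤b−a =
    ≤-trans (≤-reflexive (sym (+-identityˡ a)))
      (≤-trans (+-mono-≤ a 0≤b−a) (≤-reflexive (//-rightDividesˡ a b)))

  neg-antimono-≤ : ∀ {a b} → a ≤ b → - b ≤ - a
  neg-antimono-≤ {a} {b} a≤b =
    0≤−⇒≤ (≤-trans (≤⇒0≤− a≤b)
      (≤-reflexive (trans (+-comm b (- a)) (+-congˡ (sym (-‿involutive b))))))

  *-monoˡ-≤-nonneg : ∀ {a b c} → 0# ≤ c → a ≤ b → a * c ≤ b * c
  *-monoˡ-≤-nonneg {a} {b} {c} 0≤c a≤b =
    0≤−⇒≤ (≤-trans (*-nonneg (≤⇒0≤− a≤b) 0≤c) (≤-reflexive ([y-z]x≈yx-zx c b a)))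

  *-monoʳ-≤-nonneg : ∀ {a b c} → 0# ≤ c → a ≤ b → c * a ≤ c * b
  *-monoʳ-≤-nonneg {a} {b} {c} 0≤c a≤b =
    ≤-trans (≤-reflexive (*-comm c a))
      (≤-trans (*-monoˡ-≤-nonneg 0≤c a≤b) (≤-reflexive (*-comm b c)))

module Duality {c ℓ₁ ℓ₂} (F : OrderedField c ℓ₁ ℓ₂)
  (m n : ℕ) (adj : Fin m → Fin n → Bool)
  (rL : Fin m → Fin n → ℕ) (rR : Fin n → Fin m → ℕ) where

  open OrderedField F
  open OrderedFieldProperties F
  open CommutativeRingIdentities commutativeRing
  open LP F m n adj rL rR
  open import Algebra.Properties.Ring ring
    using (xyx⁻¹≈y; //-rightDividesʳ; -‿+-comm; -0#≈0#)
  open import Relation.Binary.Reasoning.PartialOrder poset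

  Σ-cong : ∀ k {f g : Fin k → Carrier} → (∀ i → f i ≈ g i) → Σ k f ≈ Σ k g
  Σ-cong zero    f≈g = refl
  Σ-cong (suc k) f≈g = +-cong (f≈g fzero) (Σ-cong k (λ i → f≈g (fsuc i)))

  Σ-mono-≤ : ∀ k {f g : Fin k → Carrier} → (∀ i → f i ≤ g i) → Σ k f ≤ Σ k g
  Σ-mono-≤ zero    f≤g = ≤-reflexive refl
  Σ-mono-≤ (suc k) f≤g = +-mono₂-≤ (f≤g fzero) (Σ-mono-≤ k (λ i → f≤g (fsuc i)))

  Σ-zero : ∀ k → Σ k (λ _ → 0#) ≈ 0#
  Σ-zero zero    = refl
  Σ-zero (suc k) = trans (+-congˡ (Σ-zero k)) (+-identityˡ 0#)

  Σ-nonneg : ∀ k {f : Fin k → Carrier} → (∀ i → 0# ≤ f i) → 0# ≤ Σ k f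
  Σ-nonneg k 0≤f = ≤-trans (≤-reflexive (sym (Σ-zero k))) (Σ-mono-≤ k 0≤f)

  Σ-+ : ∀ k (f g : Fin k → Carrier) → Σ k (λ i → f i + g i) ≈ Σ k f + Σ k g
  Σ-+ zero    f g = sym (+-identityˡ 0#)
  Σ-+ (suc k) f g = trans (+-congˡ (Σ-+ k _ _)) (+-interchange _ _ _ _)

  Σ-neg : ∀ k (f : Fin k → Carrier) → Σ k (λ i → - f i) ≈ - Σ k f
  Σ-neg zero    f = sym -0#≈0#
  Σ-neg (suc k) f = trans (+-congˡ (Σ-neg k _)) (-‿+-comm _ _)

  Σ-− : ∀ k (f g : Fin k → Carrier) → Σ k (λ i → f i − g i) ≈ Σ k f − Σ k g
  Σ-− k f g = trans (Σ-+ k f (λ i → - g i)) (+-congˡ (Σ-neg k g))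

  Σ-*ˡ : ∀ k a (f : Fin k → Carrier) → a * Σ k f ≈ Σ k (λ i → a * f i)
  Σ-*ˡ zero    a f = zeroʳ a
  Σ-*ˡ (suc k) a f = trans (distribˡ a _ _) (+-congˡ (Σ-*ˡ k a _))

  Σ-*ʳ : ∀ k a (f : Fin k → Carrier) → Σ k (λ i → f i * a) ≈ Σ k f * a
  Σ-*ʳ zero    a f = sym (zeroˡ a)
  Σ-*ʳ (suc k) a f = trans (+-congˡ (Σ-*ʳ k a _)) (sym (distribʳ a _ _))

  Σ-comm : ∀ k l (f : Fin k → Fin l → Carrier) →
           Σ k (λ i → Σ l (λ j → f i j)) ≈ Σ l (λ j → Σ k (λ i → f i j))
  Σ-comm zero    l f = sym (Σ-zero l)
  Σ-comm (suc k) l f = trans (+-congˡ (Σ-comm k l _)) (sym (Σ-+ l _ _))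

  Σ-[≟]· : ∀ k (f : Fin k → Carrier) j → Σ k (λ i → [ does (i ≟ j) ]· f i) ≈ f j
  Σ-[≟]· (suc k) f fzero    = trans (+-congˡ (Σ-zero k)) (+-identityʳ (f fzero))
  Σ-[≟]· (suc k) f (fsuc j) = trans (+-identityˡ _) (Σ-[≟]· k (λ i → f (fsuc i)) j)

  []·-nonneg : ∀ b {v} → (b ≡ true → 0# ≤ v) → 0# ≤ [ b ]· v
  []·-nonneg true  0≤v = 0≤v ≡.refl
  []·-nonneg false 0≤v = ≤-reflexive refl

  []·-split : ∀ a b v → [ a ]· v ≈ [ a ∧ b ]· v + [ a ∧ not b ]· v
  []·-split true  true  v = sym (+-identityʳ v)
  []·-split true  false v = sym (+-identityˡ v)
  []·-split false b     v = sym (+-identityˡ 0#)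

  []·-≤-* : ∀ b {v d} → (b ≡ true → 0# ≤ v) → (b ≡ true → 1# ≤ d) → [ b ]· v ≤ [ b ]· v * d
  []·-≤-* true  {v} 0≤v 1≤d =
    ≤-trans (≤-reflexive (sym (*-identityʳ v))) (*-monoʳ-≤-nonneg (0≤v ≡.refl) (1≤d ≡.refl))
  []·-≤-* false {d = d} _ _ = ≤-reflexive (sym (zeroˡ d))

  []·-*-comm : ∀ a u v → [ a ]· u * v ≈ [ a ]· v * u
  []·-*-comm true  u v = *-comm u v
  []·-*-comm false u v = trans (zeroˡ v) (sym (zeroˡ u))

  []·-*-[∧]·-comm : ∀ a a′ b u v → [ a ]· u * [ a′ ∧ b ]· v ≈ [ a′ ]· v * [ a ∧ b ]· u
  []·-*-[∧]·-comm true  true  true  u v = *-comm u v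
  []·-*-[∧]·-comm true  true  false u v = trans (zeroʳ u) (sym (zeroʳ v))
  []·-*-[∧]·-comm true  false b     u v = trans (zeroʳ u) (sym (zeroˡ _))
  []·-*-[∧]·-comm false a′    b     u v = trans (zeroˡ _) (sym (zeroʳ _))

  -- Sums over the neighbourhood a of a vertex whose ranking is r (smaller rank =
  -- preferred): betterL, worseL, degL and their right-hand versions are instances.
  Σ-on : ∀ {k} → (Fin k → Bool) → (Fin k → Carrier) → Carrier
  Σ-on {k} a w = Σ k (λ t → [ a t ]· w t)

  Σ-above : ∀ {k} → (Fin k → Bool) → (Fin k → ℕ) → (Fin k → Carrier) → Fin k → Carrier
  Σ-above {k} a r w j = Σ k (λ t → [ a t ∧ (r t <ᵇ r j) ]· w t)

  Σ-below : ∀ {k} → (Fin k → Bool) → (Fin k → ℕ) → (Fin k → Carrier) → Fin k → Carrier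
  Σ-below {k} a r w j = Σ k (λ t → [ a t ∧ (r j <ᵇ r t) ]· w t)

  Σ-above+self≤Σ-on−Σ-below : ∀ {k} (a : Fin k → Bool) (r : Fin k → ℕ) (w : Fin k → Carrier) j →
    a j ≡ true → (∀ t → a t ≡ true → 0# ≤ w t) →
    Σ-above a r w j + w j ≤ Σ-on a w − Σ-below a r w j
  Σ-above+self≤Σ-on−Σ-below {k} a r w j aj 0≤w = begin
    Σ-above a r w j + w j
      ≈⟨ +-congˡ (Σ-[≟]· k w j) ⟨
    Σ-above a r w j + Σ k (λ t → [ does (t ≟ j) ]· w t)
      ≈⟨ Σ-+ k _ _ ⟨
    Σ k (λ t → [ a t ∧ (r t <ᵇ r j) ]· w t + [ does (t ≟ j) ]· w t)
      ≤⟨ Σ-mono-≤ k termwise ⟩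
    Σ k (λ t → [ a t ∧ not (r j <ᵇ r t) ]· w t)
      ≈⟨ xyx⁻¹≈y (Σ-below a r w j) _ ⟨
    (Σ-below a r w j + Σ k (λ t → [ a t ∧ not (r j <ᵇ r t) ]· w t)) − Σ-below a r w j
      ≈⟨ +-congʳ (trans (Σ-cong k (λ t → []·-split (a t) (r j <ᵇ r t) (w t))) (Σ-+ k _ _)) ⟨
    Σ-on a w − Σ-below a r w j ∎
    where
    termwise : ∀ t → [ a t ∧ (r t <ᵇ r j) ]· w t + [ does (t ≟ j) ]· w t
                     ≤ [ a t ∧ not (r j <ᵇ r t) ]· w t
    termwise t with t ≟ j
    ... | yes ≡.refl rewrite aj | <?-irrefl (r t) = ≤-reflexive (+-identityˡ (w t))
    ... | no _ with a t in at | r t <ᵇ r j in t≻j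
    ...   | false | _     = ≤-reflexive (+-identityˡ 0#)
    ...   | true  | true  rewrite <?-asym t≻j = ≤-reflexive (+-identityʳ (w t))
    ...   | true  | false with r j <ᵇ r t
    ...     | true  = ≤-reflexive (+-identityˡ 0#)
    ...     | false = ≤-trans (≤-reflexive (+-identityˡ 0#)) (0≤w t at)

  Σ-*-Σ-below≈Σ-*-Σ-above : ∀ {k} (a : Fin k → Bool) (r : Fin k → ℕ) (u v : Fin k → Carrier) →
    Σ k (λ j → [ a j ]· u j * Σ-below a r v j) ≈ Σ k (λ t → [ a t ]· v t * Σ-above a r u t)
  Σ-*-Σ-below≈Σ-*-Σ-above {k} a r u v = begin-equality
    Σ k (λ j → [ a j ]· u j * Σ-below a r v j)
      ≈⟨ Σ-cong k (λ j → Σ-*ˡ k _ _) ⟩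
    Σ k (λ j → Σ k (λ t → [ a j ]· u j * [ a t ∧ (r j <ᵇ r t) ]· v t))
      ≈⟨ Σ-comm k k _ ⟩
    Σ k (λ t → Σ k (λ j → [ a j ]· u j * [ a t ∧ (r j <ᵇ r t) ]· v t))
      ≈⟨ Σ-cong k (λ t → Σ-cong k (λ j → []·-*-[∧]·-comm (a j) (a t) (r j <ᵇ r t) (u j) (v t))) ⟩
    Σ k (λ t → Σ k (λ j → [ a t ]· v t * [ a j ∧ (r j <ᵇ r t) ]· u j))
      ≈⟨ Σ-cong k (λ t → Σ-*ˡ k _ _) ⟨
    Σ k (λ t → [ a t ]· v t * Σ-above a r u t) ∎

  ΣΣ : (Fin m → Fin n → Carrier) → Carrier
  ΣΣ f = Σ m (λ i → Σ n (λ j → f i j))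

  ΣΣ-cong : ∀ {f g} → (∀ i j → f i j ≈ g i j) → ΣΣ f ≈ ΣΣ g
  ΣΣ-cong f≈g = Σ-cong m (λ i → Σ-cong n (f≈g i))

  ΣΣ-mono-≤ : ∀ {f g} → (∀ i j → f i j ≤ g i j) → ΣΣ f ≤ ΣΣ g
  ΣΣ-mono-≤ f≤g = Σ-mono-≤ m (λ i → Σ-mono-≤ n (f≤g i))

  ΣΣ-+ : ∀ f g → ΣΣ (λ i j → f i j + g i j) ≈ ΣΣ f + ΣΣ g
  ΣΣ-+ f g = trans (Σ-cong m (λ i → Σ-+ n _ _)) (Σ-+ m _ _)

  ΣΣ-− : ∀ f g → ΣΣ (λ i j → f i j − g i j) ≈ ΣΣ f − ΣΣ g
  ΣΣ-− f g = trans (Σ-cong m (λ i → Σ-− n _ _)) (Σ-− m _ _)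

  ΣΣ-+₃ : ∀ f g h → ΣΣ (λ i j → (f i j + g i j) + h i j) ≈ (ΣΣ f + ΣΣ g) + ΣΣ h
  ΣΣ-+₃ f g h = trans (ΣΣ-+ _ h) (+-congʳ (ΣΣ-+ f g))

  module _ {x : EdgeVec} (x∈FSUSM : FSUSM x) where
    open FSUSM x∈FSUSM

    deg-dualFeasible : DLPFeasible (degL x) (degR x) x
    deg-dualFeasible = record
      { cover     = cover
      ; αL-nonneg = λ i → Σ-nonneg n (λ k → []·-nonneg (adj i k) (nonneg i k))
      ; αR-nonneg = λ j → Σ-nonneg m (λ l → []·-nonneg (adj l j) (nonneg l j))
      ; β-nonneg  = nonneg
      }
      where
      cover : ∀ i j → adj i j ≡ true →
              1# ≤ (((degL x i + degR x j) − worseL x i j) − worseR x i j) − x i j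
      cover i j e = begin
        1#
          ≤⟨ stable i j e ⟩
        (betterL x i j + betterR x i j) + x i j
          ≈⟨ //-rightDividesʳ (x i j) _ ⟨
        (((betterL x i j + betterR x i j) + x i j) + x i j) − x i j
          ≈⟨ +-congʳ (+-+-shuffle _ _ _) ⟨
        ((betterL x i j + x i j) + (betterR x i j + x i j)) − x i j
          ≤⟨ +-mono-≤ (- x i j) (+-mono₂-≤
               (Σ-above+self≤Σ-on−Σ-below (adj i) (rL i) (x i) j e (nonneg i))
               (Σ-above+self≤Σ-on−Σ-below (λ l → adj l j) (rR j) (λ l → x l j) i e (λ l → nonneg l j))) ⟩
        ((degL x i − worseL x i j) + (degR x j − worseR x i j)) − x i j
          ≈⟨ −-+-shuffle _ _ _ _ _ ⟩
        (((degL x i + degR x j) − worseL x i j) − worseR x i j) − x i j ∎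

    dualObj-deg≈edgeSum : dualObj (degL x) (degR x) x ≈ edgeSum x
    dualObj-deg≈edgeSum =
      trans (+-congʳ (+-congˡ (Σ-comm n m _))) (//-rightDividesʳ (edgeSum x) (edgeSum x))

  module _ {y : EdgeVec} (y∈FSUSM : FSUSM y)
           {αL : Fin m → Carrier} {αR : Fin n → Carrier} {β : EdgeVec}
           (feasible : DLPFeasible αL αR β) where
    private
      module y = FSUSM y∈FSUSM
      module D = DLPFeasible feasible

      ŷ β̂ : Fin m → Fin n → Carrier
      ŷ i j = [ adj i j ]· y i j
      β̂ i j = [ adj i j ]· β i j

      coverValue : Fin m → Fin n → Carrier
      coverValue i j = (((αL i + αR j) − worseL β i j) − worseR β i j) − β i j

    edgeSum≤ΣΣ-*-cover : edgeSum y ≤ ΣΣ (λ i j → ŷ i j * coverValue i j)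
    edgeSum≤ΣΣ-*-cover = ΣΣ-mono-≤ (λ i j → []·-≤-* (adj i j) (y.nonneg i j) (D.cover i j))

    ΣΣ-*-cover-distrib : ΣΣ (λ i j → ŷ i j * coverValue i j) ≈
                  (ΣΣ (λ i j → ŷ i j * αL i) + ΣΣ (λ i j → ŷ i j * αR j)) −
                  ((ΣΣ (λ i j → ŷ i j * worseL β i j) + ΣΣ (λ i j → ŷ i j * worseR β i j))
                    + ΣΣ (λ i j → ŷ i j * β i j))
    ΣΣ-*-cover-distrib =
      trans (ΣΣ-cong (λ i j → *-distribˡ-cover _ _ _ _ _ _))
        (trans (ΣΣ-− _ _) (+-cong (ΣΣ-+ _ _) (-‿cong (ΣΣ-+₃ _ _ _))))

    ΣΣ-*-αL≤ΣαL : ΣΣ (λ i j → ŷ i j * αL i) ≤ Σ m αL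
    ΣΣ-*-αL≤ΣαL = begin
      ΣΣ (λ i j → ŷ i j * αL i)    ≈⟨ Σ-cong m (λ i → Σ-*ʳ n (αL i) _) ⟩
      Σ m (λ i → degL y i * αL i)  ≤⟨ Σ-mono-≤ m (λ i → *-monoˡ-≤-nonneg (D.αL-nonneg i) (y.capL i)) ⟩
      Σ m (λ i → 1# * αL i)        ≈⟨ Σ-cong m (λ i → *-identityˡ (αL i)) ⟩
      Σ m αL                       ∎

    ΣΣ-*-αR≤ΣαR : ΣΣ (λ i j → ŷ i j * αR j) ≤ Σ n αR
    ΣΣ-*-αR≤ΣαR = begin
      ΣΣ (λ i j → ŷ i j * αR j)    ≈⟨ Σ-comm m n _ ⟩
      Σ n (λ j → Σ m (λ i → ŷ i j * αR j)) ≈⟨ Σ-cong n (λ j → Σ-*ʳ m (αR j) _) ⟩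
      Σ n (λ j → degR y j * αR j)  ≤⟨ Σ-mono-≤ n (λ j → *-monoˡ-≤-nonneg (D.αR-nonneg j) (y.capR j)) ⟩
      Σ n (λ j → 1# * αR j)        ≈⟨ Σ-cong n (λ j → *-identityˡ (αR j)) ⟩
      Σ n αR                       ∎

    -- Stability of y bounds Σ β by Σ_e β_e (better_y(e) + y_e); exchanging the
    -- order of summation turns each better_y into a worse_β.
    edgeSum-β≤ΣΣ-*-worse : edgeSum β ≤ (ΣΣ (λ i j → ŷ i j * worseL β i j) + ΣΣ (λ i j → ŷ i j * worseR β i j))
                             + ΣΣ (λ i j → ŷ i j * β i j)
    edgeSum-β≤ΣΣ-*-worse = begin
      edgeSum β
        ≤⟨ ΣΣ-mono-≤ (λ i j → []·-≤-* (adj i j) (D.β-nonneg i j) (y.stable i j)) ⟩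
      ΣΣ (λ i j → β̂ i j * ((betterL y i j + betterR y i j) + y i j))
        ≈⟨ trans (ΣΣ-cong (λ i j → *-distribˡ-+₃ _ _ _ _)) (ΣΣ-+₃ _ _ _) ⟩
      (ΣΣ (λ i j → β̂ i j * betterL y i j) + ΣΣ (λ i j → β̂ i j * betterR y i j))
        + ΣΣ (λ i j → β̂ i j * y i j)
        ≈⟨ +-cong (+-cong exchangeL exchangeR) (ΣΣ-cong (λ i j → []·-*-comm (adj i j) (β i j) (y i j))) ⟩
      (ΣΣ (λ i j → ŷ i j * worseL β i j) + ΣΣ (λ i j → ŷ i j * worseR β i j))
        + ΣΣ (λ i j → ŷ i j * β i j) ∎
      where
      exchangeL : ΣΣ (λ i j → β̂ i j * betterL y i j) ≈ ΣΣ (λ i j → ŷ i j * worseL β i j)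
      exchangeL = sym (Σ-cong m (λ i → Σ-*-Σ-below≈Σ-*-Σ-above (adj i) (rL i) (y i) (β i)))

      exchangeR : ΣΣ (λ i j → β̂ i j * betterR y i j) ≈ ΣΣ (λ i j → ŷ i j * worseR β i j)
      exchangeR = sym (trans (Σ-comm m n _)
        (trans (Σ-cong n (λ j → Σ-*-Σ-below≈Σ-*-Σ-above (λ l → adj l j) (rR j) (λ l → y l j) (λ l → β l j)))
          (Σ-comm n m _)))

    weak-duality : edgeSum y ≤ dualObj αL αR β
    weak-duality = begin
      edgeSum y
        ≤⟨ edgeSum≤ΣΣ-*-cover ⟩
      ΣΣ (λ i j → ŷ i j * coverValue i j)
        ≈⟨ ΣΣ-*-cover-distrib ⟩
      (ΣΣ (λ i j → ŷ i j * αL i) + ΣΣ (λ i j → ŷ i j * αR j)) −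
      ((ΣΣ (λ i j → ŷ i j * worseL β i j) + ΣΣ (λ i j → ŷ i j * worseR β i j))
        + ΣΣ (λ i j → ŷ i j * β i j))
        ≤⟨ +-mono₂-≤ (+-mono₂-≤ ΣΣ-*-αL≤ΣαL ΣΣ-*-αR≤ΣαR) (neg-antimono-≤ edgeSum-β≤ΣΣ-*-worse) ⟩
      dualObj αL αR β ∎

mainTheorem7 : ∀ {c ℓ₁ ℓ₂} (F : OrderedField c ℓ₁ ℓ₂)
    (m n : ℕ) (adj : Fin m → Fin n → Bool)
    (rL : Fin m → Fin n → ℕ) (rR : Fin n → Fin m → ℕ)
    (x : LP.EdgeVec F m n adj rL rR) →
    LP.FSUSM F m n adj rL rR x →
    LP.LPOptimal F m n adj rL rR x
    × LP.DLPOptimal F m n adj rL rR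
        (LP.degL F m n adj rL rR x) (LP.degR F m n adj rL rR x) x
mainTheorem7 F m n adj rL rR x x∈FSUSM =
    (x∈FSUSM , λ y y∈FSUSM → begin
       edgeSum y                         ≤⟨ weak-duality y∈FSUSM (deg-dualFeasible x∈FSUSM) ⟩
       dualObj (degL x) (degR x) x       ≈⟨ dualObj-deg≈edgeSum x∈FSUSM ⟩
       edgeSum x                         ∎)
  , (deg-dualFeasible x∈FSUSM , λ αL αR β feasible → begin
       dualObj (degL x) (degR x) x       ≈⟨ dualObj-deg≈edgeSum x∈FSUSM ⟩
       edgeSum x                         ≤⟨ weak-duality x∈FSUSM feasible ⟩
       dualObj αL αR β                   ∎)
  where
  open LP F m n adj rL rR
  open Duality F m n adj rL rR
  open import Relation.Binary.Reasoning.PartialOrder (OrderedFieldProperties.poset F)
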